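{- Let $\Gamma(n,d)$ be the digraph defined in the context (for integers $d\geq 2$, $n\geq d+1$). (i) If $d+1\leq n\leq d^2+1$, then $\Gamma(n,d)$ has diameter $d$ and $\dim(\Gamma(n,d))=1=f(n,d)$. (ii) For every $n\geq 3$, $\Gamma(n,2)$ has diameter $2$ and $\dim(\Gamma(n,2))=f(n,2)$. (iii) For every $n\geq 4$, $\Gamma(n,3)$ has diameter $3$ and $\dim(\Gamma(n,3))=f(n,3)$.
   Context: Digraphs are finite, simple, strongly connected; $\partial(x,y)$ is the length of a shortest directed path from $x$ to $y$, $\tilde\partial(x,y)=(\partial(x,y),\partial(y,x))$, diameter $=\max\partial(x,y)$. A vertex set $\{w_1,\dots,w_m\}$ is weakly resolving if $(\tilde\partial(w_1,u),\dots,\tilde\partial(w_m,u))\neq(\tilde\partial(w_1,v),\dots,\tilde\partial(w_m,v))$ for all distinct $u,v$; $\dim$ is the minimum size of such a set. $f(n,d)$ is the least positive integer $k$ with $k+d^{2k}\geq n$. Construction of $\Gamma(n,d)$ for integers $n,d$ with $3\leq d+1\leq n$: let $k=f(n,d)$ and $m=n-k$ (so $m\leq d^{2k}$). For $i\in\{1,\dots,m\}$ let $v_i=(x_1,\dots,x_{2k})$ be the unique sequence with each $x_r\in\{1,\dots,d\}$ and $i=x_1+(x_2-1)d+(x_3-1)d^2+\dots+(x_{2k}-1)d^{2k-1}$. The vertex set is $\{u_1,\dots,u_k\}\cup\{v_1,\dots,v_m\}$ ($n$ vertices), and the arcs are exactly: (F1) $(u_i,v_j)$ iff $a_{2i-1}=1$,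 where $v_j=(a_1,\dots,a_{2k})$; (F2) $(v_j,u_i)$ iff $a_{2i}=1$; (F3) $(v_j,v_l)$ iff $v_j\neq v_l$ and $a_{2r-1}-b_{2r-1}\geq-1$ and $a_{2r}-b_{2r}\leq 1$ for all $r=1,\dots,k$, where $v_l=(b_1,\dots,b_{2k})$. There are no other arcs. -}

module Defs where

open import Data.Nat using (ℕ; zero; suc; _+_; _*_; _∸_; _^_; _≤_; _<_)
open import Data.Nat.DivMod using (_/_; _%_)
open import Data.Fin using (Fin; toℕ)
open import Data.Sum using (_⊎_; inj₁; inj₂)
open import Data.Product using (_×_; ∃; ∃-syntax)
open import Data.List using (List; length)
open import Data.List.Membership.Propositional using (_∈_)
open import Data.Empty using (⊥)
open import Relation.Nullary using (¬_)
open import Relation.Binary.PropositionalEquality using (_≡_; _≢_)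
open import Function.Bundles using (_⇔_)

module _ {V : Set} (E : V → V → Set) where

  data Walk : V → V → ℕ → Set where
    here : ∀ {x} → Walk x x 0
    step : ∀ {x z y k} → E x z → Walk z y k → Walk x y (suc k)

  IsDist : V → V → ℕ → Set
  IsDist x y k = Walk x y k × (∀ j → j < k → ¬ Walk x y j)

  HasDiameter : ℕ → Set
  HasDiameter D =
    (∀ x y → ∃[ k ] (IsDist x y k × k ≤ D)) × ∃[ x ] ∃[ y ] IsDist x y D

  SameBiDist : V → V → V → Set
  SameBiDist w u v =
    (∀ k → IsDist w u k ⇔ IsDist w v k) × (∀ k → IsDist u w k ⇔ IsDist v w k)

  WeaklyResolving : List V → Set
  WeaklyResolving W = ∀ u v → (∀ w → w ∈ W → SameBiDist w u v) → u ≡ v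

  HasDim : ℕ → Set
  HasDim m =
    (∃[ W ] (length W ≡ m × WeaklyResolving W))
    × (∀ W → WeaklyResolving W → m ≤ length W)

IsF : ℕ → ℕ → ℕ → Set
IsF n d k = 1 ≤ k × n ≤ k + d ^ (2 * k)
          × (∀ j → 1 ≤ j → j < k → j + d ^ (2 * j) < n)

-- The construction Γ(n,d), given k = f(n,d) (passed as a parameter).

-- digit d r j : the r-th (0-indexed) base-d digit of j.
-- (d = 0 is a junk case, never used: the statement assumes d ≥ 2.)
digit : ℕ → ℕ → ℕ → ℕ
digit zero    r       j = 0
digit (suc d) zero    j = j % suc d
digit (suc d) (suc r) j = digit (suc d) r (j / suc d)

-- Vertices: inj₁ i is u_{i+1} (i : Fin k); inj₂ j is v_{j+1} (j : Fin m),
-- m = n - k.  The sequence v_{j+1} = (a_1,…,a_{2k}) has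
-- a_{r+1} = 1 + digit d r j, since j+1 = 1 + Σ_r (a_{r+1} - 1) d^r.
ΓV : ℕ → ℕ → Set
ΓV n k = Fin k ⊎ Fin (n ∸ k)

ΓE : (n d k : ℕ) → ΓV n k → ΓV n k → Set
ΓE n d k (inj₁ i) (inj₁ i′) = ⊥
-- (F1) (u_i, v_j) iff a_{2i-1} = 1
ΓE n d k (inj₁ i) (inj₂ j) = digit d (2 * toℕ i) (toℕ j) ≡ 0
-- (F2) (v_j, u_i) iff a_{2i} = 1
ΓE n d k (inj₂ j) (inj₁ i) = digit d (suc (2 * toℕ i)) (toℕ j) ≡ 0
-- (F3) (v_j, v_l) iff v_j ≠ v_l, a_{2r-1} - b_{2r-1} ≥ -1, a_{2r} - b_{2r} ≤ 1
ΓE n d k (inj₂ j) (inj₂ l) =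
  j ≢ l ×
  (∀ (r : Fin k) →
     digit d (2 * toℕ r) (toℕ l) ≤ suc (digit d (2 * toℕ r) (toℕ j))
   × digit d (suc (2 * toℕ r)) (toℕ j) ≤ suc (digit d (suc (2 * toℕ r)) (toℕ l)))

module Submission where

-- Read v_j through the base-d digits of j - 1, i.e. the numbers a_r - 1. An arc v → v′ raises each
-- digit in an odd position by at most one and lowers each digit in an even position by at most one, and
-- u_i → v (resp. v → u_i) is an arc iff v has digit 0 in position 2i - 1 (resp. 2i).
-- For d ≤ 3 every digit lies in {0,1,2} and equals min(2, ∂ - 1) for the distance ∂ from or to the
-- matching u_i, so {u_1,…,u_k} is weakly resolving; for k = 1 the two digits of v are exactly
-- ∂(u,v) - 1 and ∂(v,u) - 1, since one arc changes a digit by at most one.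
-- Conversely, when the diameter is at most d, a vertex outside a weakly resolving set W is determined by
-- its 2|W| distances to and from W, all in {1,…,d}; hence n ≤ |W| + d^(2|W|), and the minimality of
-- k = f(n,d) gives |W| ≥ k.
-- The diameter bounds come from explicit routes through v_1 = (1,…,1) or through vertices with some
-- digits lowered.

open import Defs
open import Data.Nat
open import Data.Nat.Properties
open import Data.Nat.DivMod
open import Data.Nat.Induction using (<-rec)
open import Data.Fin as Fin using (Fin; toℕ; fromℕ<; splitAt; join)
open import Data.Fin.Properties using (toℕ<n; toℕ-injective; toℕ-fromℕ<; injective⇒≤; join-splitAt; any?; all?)
import Data.Fin.Properties as Finₚ
open import Data.Product using (_×_; _,_; proj₁; proj₂; ∃; ∃-syntax)
open import Data.Sum using (_⊎_; inj₁; inj₂)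
open import Data.Sum.Properties using (≡-dec)
open import Data.List using (List; []; _∷_; length; map; allFin; lookup)
open import Data.List.Properties using (length-map; length-tabulate)
open import Data.List.Membership.Propositional using (_∈_; _∉_)
open import Data.List.Membership.Propositional.Properties using (∈-map⁺; ∈-allFin)
import Data.List.Membership.DecPropositional as DecMembership
open import Data.List.Relation.Unary.Any using (here; there; index)
open import Data.List.Relation.Unary.Any.Properties using (lookup-index)
open import Function using (_∘_)
open import Function.Bundles using (_⇔_; mk⇔; Equivalence)
open import Relation.Binary.Definitions using (DecidableEquality)
open import Relation.Binary.PropositionalEquality
open import Relation.Nullary using (Dec; yes; no; ¬?; contradiction)
open import Relation.Nullary.Decidable using (map′; _×-dec_)

module Digits (d : ℕ) where

  D : ℕ
  D = suc d

  [x+y*D]/D≡y : ∀ x y → x < D → (x + y * D) / D ≡ y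
  [x+y*D]/D≡y x y x<D = begin
      (x + y * D) / D    ≡⟨ +-distrib-/ x (y * D) no-carry ⟩
      x / D + y * D / D  ≡⟨ cong₂ _+_ (m<n⇒m/n≡0 x<D) (m*n/n≡m y D) ⟩
      y                  ∎
    where
    open ≡-Reasoning
    no-carry : x % D + (y * D) % D < D
    no-carry = subst (λ r → x % D + r < D) (sym (m*n%n≡0 y D))
                 (subst (_< D) (sym (+-identityʳ (x % D))) (m%n<n x D))

  [x+y*D]%D≡x : ∀ x y → x < D → (x + y * D) % D ≡ x
  [x+y*D]%D≡x x y x<D = trans ([m+kn]%n≡m%n x y D) (m<n⇒m%n≡m x<D)

  x+y*D-injective : ∀ {x y x′ y′} → x < D → x′ < D → x + y * D ≡ x′ + y′ * D → x ≡ x′ × y ≡ y′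
  x+y*D-injective {x} {y} {x′} {y′} x<D x′<D eq =
    trans (sym ([x+y*D]%D≡x x y x<D)) (trans (cong (_% D) eq) ([x+y*D]%D≡x x′ y′ x′<D)) ,
    trans (sym ([x+y*D]/D≡y x y x<D)) (trans (cong (_/ D) eq) ([x+y*D]/D≡y x′ y′ x′<D))

  x+y*D<D*z : ∀ {x y z} → x < D → y < z → x + y * D < D * z
  x+y*D<D*z {x} {y} {z} x<D y<z = begin-strict
      x + y * D  <⟨ +-monoˡ-< (y * D) x<D ⟩
      D + y * D  ≡⟨ *-comm (suc y) D ⟩
      D * suc y  ≤⟨ *-monoʳ-≤ D y<z ⟩
      D * z      ∎
    where open ≤-Reasoning

  digit-< : ∀ p j → digit D p j < D
  digit-< zero    j = m%n<n j D
  digit-< (suc p) j = digit-< p (j / D)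

  x+y*D-mono-≤ : ∀ {x y x′ y′} → x ≤ x′ → y ≤ y′ → x + y * D ≤ x′ + y′ * D
  x+y*D-mono-≤ x≤x′ y≤y′ = +-mono-≤ x≤x′ (*-monoˡ-≤ D y≤y′)

  x+y*D<x′+y′*D : ∀ {x y x′ y′} → x < D → y < y′ → x + y * D < x′ + y′ * D
  x+y*D<x′+y′*D {x} {y} {x′} {y′} x<D y<y′ = begin-strict
      x + y * D   <⟨ +-monoˡ-< (y * D) x<D ⟩
      suc y * D   ≤⟨ *-monoˡ-≤ D y<y′ ⟩
      y′ * D      ≤⟨ m≤n+m (y′ * D) x′ ⟩
      x′ + y′ * D ∎
    where open ≤-Reasoning

  digit-of-0 : ∀ p → digit D p 0 ≡ 0
  digit-of-0 zero    = refl
  digit-of-0 (suc p) = digit-of-0 p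

  digit-head : ∀ {x} y → x < D → digit D 0 (x + y * D) ≡ x
  digit-head y x<D = [x+y*D]%D≡x _ y x<D

  digit-tail : ∀ p {x} y → x < D → digit D (suc p) (x + y * D) ≡ digit D p y
  digit-tail p y x<D = cong (digit D p) ([x+y*D]/D≡y _ y x<D)

  fromDigits : (ℕ → ℕ) → ℕ → ℕ
  fromDigits g zero    = 0
  fromDigits g (suc R) = g 0 + fromDigits (g ∘ suc) R * D

  DigitsBelow : ℕ → (ℕ → ℕ) → Set
  DigitsBelow R g = ∀ p → p < R → g p < D

  digit-fromDigits : ∀ R g → DigitsBelow R g → ∀ p → p < R → digit D p (fromDigits g R) ≡ g p
  digit-fromDigits (suc R) g g< zero    _         = digit-head (fromDigits (g ∘ suc) R) (g< 0 z<s)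
  digit-fromDigits (suc R) g g< (suc p) (s≤s p<R) = trans
    (digit-tail p (fromDigits (g ∘ suc) R) (g< 0 z<s))
    (digit-fromDigits R (g ∘ suc) (λ q q<R → g< (suc q) (s≤s q<R)) p p<R)

  fromDigits-< : ∀ R g → DigitsBelow R g → fromDigits g R < D ^ R
  fromDigits-< zero    g g< = z<s
  fromDigits-< (suc R) g g< =
    x+y*D<D*z (g< 0 z<s) (fromDigits-< R (g ∘ suc) (λ q q<R → g< (suc q) (s≤s q<R)))

  fromDigits-mono-≤ : ∀ R g h → (∀ p → p < R → g p ≤ h p) → fromDigits g R ≤ fromDigits h R
  fromDigits-mono-≤ zero    g h g≤h = z≤n
  fromDigits-mono-≤ (suc R) g h g≤h = +-mono-≤ (g≤h 0 z<s)
    (*-monoˡ-≤ D (fromDigits-mono-≤ R (g ∘ suc) (h ∘ suc) (λ q q<R → g≤h (suc q) (s≤s q<R))))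

  fromDigits-digit : ∀ R j → j < D ^ R → fromDigits (λ p → digit D p j) R ≡ j
  fromDigits-digit zero    zero    _         = refl
  fromDigits-digit zero    (suc j) (s≤s ())
  fromDigits-digit (suc R) j       j<D^R     = begin
      j % D + fromDigits (λ p → digit D p (j / D)) R * D
        ≡⟨ cong (λ z → j % D + z * D) (fromDigits-digit R (j / D) (m<n*o⇒m/o<n j<D^R*D)) ⟩
      j % D + (j / D) * D
        ≡⟨ sym (m≡m%n+[m/n]*n j D) ⟩
      j ∎
    where
    open ≡-Reasoning
    j<D^R*D : j < D ^ R * D
    j<D^R*D rewrite *-comm (D ^ R) D = j<D^R

  digit-injective : ∀ R {j l} → j < D ^ R → l < D ^ R →
                    (∀ p → p < R → digit D p j ≡ digit D p l) → j ≡ l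
  digit-injective R {j} {l} j< l< same = begin
      j                                   ≡⟨ sym (fromDigits-digit R j j<) ⟩
      fromDigits (λ p → digit D p j) R    ≡⟨ fromDigits-cong R same ⟩
      fromDigits (λ p → digit D p l) R    ≡⟨ fromDigits-digit R l l< ⟩
      l                                   ∎
    where
    open ≡-Reasoning
    fromDigits-cong : ∀ R {g h} → (∀ p → p < R → g p ≡ h p) → fromDigits g R ≡ fromDigits h R
    fromDigits-cong zero    g≡h = refl
    fromDigits-cong (suc R) g≡h = cong₂ (λ a b → a + b * D) (g≡h 0 z<s)
      (fromDigits-cong R (λ q q<R → g≡h (suc q) (s≤s q<R)))

module Walks {V : Set} (E : V → V → Set) where

  Reach : V → V → ℕ → Set
  Reach x y s = ∃[ t ] (t ≤ s × Walk E x y t)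

  _++ʷ_ : ∀ {x y z a b} → Walk E x y a → Walk E y z b → Walk E x z (a + b)
  here     ++ʷ w = w
  step e v ++ʷ w = step e (v ++ʷ w)

  reach-refl : ∀ {x s} → Reach x x s
  reach-refl = 0 , z≤n , here

  reach-arc : ∀ {x y} → E x y → Reach x y 1
  reach-arc e = 1 , ≤-refl , step e here

  reach-trans : ∀ {x y z a b} → Reach x y a → Reach y z b → Reach x z (a + b)
  reach-trans (t , t≤a , v) (t′ , t′≤b , w) = t + t′ , +-mono-≤ t≤a t′≤b , v ++ʷ w

  reach-mono : ∀ {x y a b} → a ≤ b → Reach x y a → Reach x y b
  reach-mono a≤b (t , t≤a , w) = t , ≤-trans t≤a a≤b , w

  walk₀⇒≡ : ∀ {x y} → Walk E x y 0 → x ≡ y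
  walk₀⇒≡ here = refl

  isDist-refl : ∀ {x} → IsDist E x x 0
  isDist-refl = here , λ _ ()

  isDist-unique : ∀ {x y a b} → IsDist E x y a → IsDist E x y b → a ≡ b
  isDist-unique {a = a} {b} (wa , a-least) (wb , b-least) =
    ≤-antisym (≮⇒≥ λ b<a → a-least b b<a wb) (≮⇒≥ λ a<b → b-least a a<b wa)

  reach⇒isDist-if-least : ∀ {x y s} → Reach x y s → (∀ t → Walk E x y t → s ≤ t) → IsDist E x y s
  reach⇒isDist-if-least (t , t≤s , w) s-least with ≤-antisym t≤s (s-least t w)
  ... | refl = w , λ j j<t w′ → <⇒≱ j<t (s-least j w′)

  module Shortest (_≟_ : DecidableEquality V) (E? : ∀ x y → Dec (E x y))
                  (∃? : {P : V → Set} → (∀ z → Dec (P z)) → Dec (∃ P)) where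

    walk? : ∀ x y t → Dec (Walk E x y t)
    walk? x y zero with x ≟ y
    ... | yes refl = yes here
    ... | no  x≢y  = no (x≢y ∘ walk₀⇒≡)
    walk? x y (suc t) = map′ (λ (z , e , w) → step e w) (λ { (step {z = z} e w) → z , e , w })
      (∃? (λ z → E? x z ×-dec walk? z y t))

    shortest : ∀ {x y} s → Walk E x y s → ∃[ t ] (t ≤ s × IsDist E x y t)
    shortest {x} {y} = <-rec _ go
      where
      go : ∀ s → (∀ {r} → r < s → Walk E x y r → ∃[ t ] (t ≤ r × IsDist E x y t)) →
           Walk E x y s → ∃[ t ] (t ≤ s × IsDist E x y t)
      go s rec w with any? (λ (r : Fin s) → walk? x y (toℕ r))
      ... | yes (r , w′) = let t , t≤r , dist = rec (toℕ<n r) w′ in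
                           t , ≤-trans t≤r (<⇒≤ (toℕ<n r)) , dist
      ... | no  none     = s , ≤-refl , w , λ r r<s w′ →
                           none (fromℕ< r<s , subst (Walk E x y) (sym (toℕ-fromℕ< r<s)) w′)

    reach⇒isDist : ∀ {x y s} → Reach x y s → ∃[ t ] (IsDist E x y t × t ≤ s)
    reach⇒isDist (t , t≤s , w) with shortest t w
    ... | t′ , t′≤t , dist = t′ , dist , ≤-trans t′≤t t≤s

module ResolvingBound {V : Set} (E : V → V → Set) (_≟_ : DecidableEquality V) (d : ℕ)
                      (diameter≤ : ∀ x y → ∃[ t ] (IsDist E x y t × t ≤ suc d)) where

  open Digits d
  open Walks E
  open DecMembership _≟_ using (_∈?_)

  dist : V → V → ℕ
  dist x y = proj₁ (diameter≤ x y)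

  dist-isDist : ∀ x y → IsDist E x y (dist x y)
  dist-isDist x y = proj₁ (proj₂ (diameter≤ x y))

  dist-pred-< : ∀ x y → x ≢ y → dist x y ∸ 1 < D
  dist-pred-< x y x≢y with dist x y | dist-isDist x y | proj₂ (proj₂ (diameter≤ x y))
  ... | zero  | w , _ | _       = contradiction (walk₀⇒≡ w) x≢y
  ... | suc t | _     | s≤s t≤d = s≤s t≤d

  dist-pred-injective : ∀ x y x′ y′ → x ≢ y → x′ ≢ y′ →
                        dist x y ∸ 1 ≡ dist x′ y′ ∸ 1 → dist x y ≡ dist x′ y′
  dist-pred-injective x y x′ y′ x≢y x′≢y′ eq
    with dist x y | dist-isDist x y | dist x′ y′ | dist-isDist x′ y′
  ... | zero  | w , _ | _      | _      = contradiction (walk₀⇒≡ w) x≢y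
  ... | suc _ | _     | zero   | w , _  = contradiction (walk₀⇒≡ w) x′≢y′
  ... | suc _ | _     | suc _  | _      = cong suc eq

  sameBiDist-if-same-dist : ∀ w u v → dist w u ≡ dist w v → dist u w ≡ dist v w → SameBiDist E w u v
  sameBiDist-if-same-dist w u v out≡ in≡ =
    (λ _ → transport (dist-isDist w u) (dist-isDist w v) out≡) ,
    (λ _ → transport (dist-isDist u w) (dist-isDist v w) in≡)
    where
    transport : ∀ {x y x′ y′ a b k} → IsDist E x y a → IsDist E x′ y′ b → a ≡ b →
                IsDist E x y k ⇔ IsDist E x′ y′ k
    transport da db refl = mk⇔ (λ dk → subst (IsDist E _ _) (isDist-unique da dk) db)
                               (λ dk → subst (IsDist E _ _) (isDist-unique db dk) da)

  profile : List V → V → ℕ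
  profile []      u = 0
  profile (w ∷ W) u = (dist w u ∸ 1) + ((dist u w ∸ 1) + profile W u * D) * D

  profile-< : ∀ W u → u ∉ W → profile W u < D ^ (2 * length W)
  profile-< []      u _   = s≤s z≤n
  profile-< (w ∷ W) u u∉ = subst (profile (w ∷ W) u <_) (sym (cong (D ^_) (*-suc 2 (length W))))
    (x+y*D<D*z (dist-pred-< w u (u∉ ∘ here ∘ sym))
      (x+y*D<D*z (dist-pred-< u w (u∉ ∘ here)) (profile-< W u (u∉ ∘ there))))

  profile-∷-injective : ∀ w W u v → u ∉ w ∷ W → v ∉ w ∷ W → profile (w ∷ W) u ≡ profile (w ∷ W) v →
                        dist w u ≡ dist w v × dist u w ≡ dist v w × profile W u ≡ profile W v
  profile-∷-injective w W u v u∉ v∉ eq =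
    dist-pred-injective w u w v w≢u w≢v (proj₁ outer) ,
    dist-pred-injective u w v w (w≢u ∘ sym) (w≢v ∘ sym) (proj₁ inner) ,
    proj₂ inner
    where
    w≢u : w ≢ u
    w≢u = u∉ ∘ here ∘ sym
    w≢v : w ≢ v
    w≢v = v∉ ∘ here ∘ sym
    outer : dist w u ∸ 1 ≡ dist w v ∸ 1 × (dist u w ∸ 1) + profile W u * D ≡ (dist v w ∸ 1) + profile W v * D
    outer = x+y*D-injective (dist-pred-< w u w≢u) (dist-pred-< w v w≢v) eq
    inner : dist u w ∸ 1 ≡ dist v w ∸ 1 × profile W u ≡ profile W v
    inner = x+y*D-injective (dist-pred-< u w (w≢u ∘ sym)) (dist-pred-< v w (w≢v ∘ sym)) (proj₂ outer)

  profile-injective : ∀ W u v → u ∉ W → v ∉ W → profile W u ≡ profile W v →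
                      ∀ w → w ∈ W → SameBiDist E w u v
  profile-injective (w ∷ W) u v u∉ v∉ eq w (here refl) =
    let out≡ , in≡ , _ = profile-∷-injective w W u v u∉ v∉ eq in sameBiDist-if-same-dist w u v out≡ in≡
  profile-injective (w ∷ W) u v u∉ v∉ eq w′ (there w′∈W) =
    let _ , _ , tail≡ = profile-∷-injective w W u v u∉ v∉ eq in
    profile-injective W u v (u∉ ∘ there) (v∉ ∘ there) tail≡ w′ w′∈W

  module _ (W : List V) (resolving : WeaklyResolving E W) where

    L : ℕ
    L = length W

    code : ∀ u → Dec (u ∈ W) → ℕ
    code u (yes u∈) = toℕ (index u∈)
    code u (no u∉)  = L + profile W u

    code-< : ∀ u u∈? → code u u∈? < L + D ^ (2 * L)
    code-< u (yes u∈) = ≤-trans (toℕ<n (index u∈)) (m≤m+n L _)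
    code-< u (no u∉)  = +-monoʳ-< L (profile-< W u u∉)

    code-injective : ∀ u v u∈? v∈? → code u u∈? ≡ code v v∈? → u ≡ v
    code-injective u v (yes u∈) (yes v∈) eq = trans (lookup-index u∈)
      (trans (cong (lookup W) (toℕ-injective eq)) (sym (lookup-index v∈)))
    code-injective u v (yes u∈) (no _)   eq = contradiction eq (<⇒≢ (≤-trans (toℕ<n (index u∈)) (m≤m+n L _)))
    code-injective u v (no _)   (yes v∈) eq = contradiction (sym eq) (<⇒≢ (≤-trans (toℕ<n (index v∈)) (m≤m+n L _)))
    code-injective u v (no u∉)  (no v∉)  eq =
      resolving u v (profile-injective W u v u∉ v∉ (+-cancelˡ-≡ L _ _ eq))

    resolving-bound : ∀ N (ι : Fin N → V) → (∀ {i j} → ι i ≡ ι j → i ≡ j) → N ≤ L + D ^ (2 * L)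
    resolving-bound N ι ι-injective = injective⇒≤ {f = codeFin} codeFin-injective
      where
      codeFin : Fin N → Fin (L + D ^ (2 * L))
      codeFin i = fromℕ< (code-< (ι i) (ι i ∈? W))
      codeFin-injective : ∀ {i j} → codeFin i ≡ codeFin j → i ≡ j
      codeFin-injective {i} {j} eq = ι-injective (code-injective (ι i) (ι j) (ι i ∈? W) (ι j ∈? W)
        (trans (sym (toℕ-fromℕ< (code-< (ι i) (ι i ∈? W))))
          (trans (cong toℕ eq) (toℕ-fromℕ< (code-< (ι j) (ι j ∈? W))))))

isF-least : ∀ {n D k} L → IsF n D k → 2 ≤ n → n ≤ L + D ^ (2 * L) → k ≤ L
isF-least zero    _                       2≤n n≤1 = contradiction (≤-trans 2≤n n≤1) λ { (s≤s ()) }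
isF-least {k = k} (suc L) (_ , _ , below) 2≤n n≤ with k ≤? suc L
... | yes k≤ = k≤
... | no  k≰ = contradiction n≤ (<⇒≱ (below (suc L) (s≤s z≤n) (≰⇒> k≰)))

isF⇒n∸k≤D^2k : ∀ {n D k} → IsF n D k → n ∸ k ≤ D ^ (2 * k)
isF⇒n∸k≤D^2k {k = k} (_ , n≤ , _) = ≤-trans (∸-monoˡ-≤ k n≤) (≤-reflexive (m+n∸m≡n k _))

-- For k ≥ 2 the minimality of k at k - 1 gives n > (k - 1) + D^(2(k-1)) ≥ k + 3.
isF⇒≤n∸k : ∀ {n d k c} → IsF n (suc (suc d)) k → c ≤ 3 → c < n → c ≤ n ∸ k
isF⇒≤n∸k {k = suc zero}         _             _   c<n = ∸-monoˡ-≤ 1 c<n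
isF⇒≤n∸k {n} {d} {suc (suc k)} {c} (_ , _ , below) c≤3 _ =
  ≤-trans (≤-reflexive (sym (m+n∸m≡n (2 + k) c))) (∸-monoˡ-≤ (2 + k) 2+k+c≤n)
  where
  D : ℕ
  D = suc (suc d)
  4≤D^2[k+1] : 4 ≤ D ^ (2 * suc k)
  4≤D^2[k+1] = subst (4 ≤_) (sym (cong (D ^_) (*-suc 2 k)))
    (*-mono-≤ {2} {D} (s≤s (s≤s z≤n)) (*-mono-≤ {2} {D} {1} (s≤s (s≤s z≤n)) (m^n>0 D (2 * k))))
  2+k+c≤n : 2 + k + c ≤ n
  2+k+c≤n = begin
    2 + k + c              ≤⟨ +-monoʳ-≤ (2 + k) c≤3 ⟩
    2 + k + 3              ≡⟨ sym (+-suc (suc k) 3) ⟩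
    suc k + 4              ≤⟨ +-monoʳ-≤ (suc k) 4≤D^2[k+1] ⟩
    suc k + D ^ (2 * suc k) <⟨ below (suc k) (s≤s z≤n) ≤-refl ⟩
    n                      ∎
    where open ≤-Reasoning

1+2*-mono-< : ∀ {r k} → r < k → suc (2 * r) < 2 * k
1+2*-mono-< {r} r<k = ≤-trans (≤-reflexive (sym (*-suc 2 r))) (*-monoʳ-≤ 2 r<k)

position-split : ∀ {k} p → p < 2 * k → ∃[ i ] (p ≡ 2 * toℕ {k} i ⊎ p ≡ suc (2 * toℕ i))
position-split {suc k} zero          _      = Fin.zero , inj₁ refl
position-split {suc k} (suc zero)    _      = Fin.zero , inj₂ refl
position-split {suc k} (suc (suc p)) p+2<2k with position-split {k} p p<2k
  where
  p<2k : p < 2 * k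
  p<2k = ≤-pred (≤-pred (subst (suc (suc (suc p)) ≤_) (*-suc 2 k) p+2<2k))
... | i , inj₁ refl = Fin.suc i , inj₁ (sym (*-suc 2 (toℕ i)))
... | i , inj₂ refl = Fin.suc i , inj₂ (cong suc (sym (*-suc 2 (toℕ i))))

2⊓[t∸1]≡d⇒t≡1+d : ∀ {d t} → 1 ≤ d → d ≤ 2 → t ≤ suc d → d ≡ 2 ⊓ (t ∸ 1) → t ≡ suc d
2⊓[t∸1]≡d⇒t≡1+d {1} {2} _ _ _ _ = refl
2⊓[t∸1]≡d⇒t≡1+d {2} {3} _ _ _ _ = refl
2⊓[t∸1]≡d⇒t≡1+d {1} {0} _ _ _ ()
2⊓[t∸1]≡d⇒t≡1+d {1} {1} _ _ _ ()
2⊓[t∸1]≡d⇒t≡1+d {2} {0} _ _ _ ()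
2⊓[t∸1]≡d⇒t≡1+d {2} {1} _ _ _ ()
2⊓[t∸1]≡d⇒t≡1+d {2} {2} _ _ _ ()
2⊓[t∸1]≡d⇒t≡1+d {1} {suc (suc (suc _))} _ _ (s≤s (s≤s ())) _
2⊓[t∸1]≡d⇒t≡1+d {2} {suc (suc (suc (suc _)))} _ _ (s≤s (s≤s (s≤s ()))) _
2⊓[t∸1]≡d⇒t≡1+d {suc (suc (suc _))} _ (s≤s (s≤s ())) _ _

module Γ (n d k : ℕ) where

  open Digits d public

  m : ℕ
  m = n ∸ k

  V : Set
  V = ΓV n k

  E : V → V → Set
  E = ΓE n D k

  open Walks E public

  -- coord p j is a_{p+1} - 1 for the vertex v_{j+1} = (a_1, …, a_{2k}).
  coord : ℕ → Fin m → ℕ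
  coord p j = digit D p (toℕ j)

  WithinOne : Fin m → Fin m → Set
  WithinOne j l = ∀ (r : Fin k) →
    coord (2 * toℕ r) l ≤ suc (coord (2 * toℕ r) j) × coord (suc (2 * toℕ r)) j ≤ suc (coord (suc (2 * toℕ r)) l)

  reach-withinOne : ∀ {j l} → WithinOne j l → Reach (inj₂ j) (inj₂ l) 1
  reach-withinOne {j} {l} within with j Fin.≟ l
  ... | yes refl = reach-refl
  ... | no  j≢l  = reach-arc (j≢l , within)

  _≟ᵛ_ : DecidableEquality V
  _≟ᵛ_ = ≡-dec Finₚ._≟_ Finₚ._≟_

  E? : ∀ x y → Dec (E x y)
  E? (inj₁ _) (inj₁ _) = no λ ()
  E? (inj₁ _) (inj₂ _) = _ ≟ 0
  E? (inj₂ _) (inj₁ _) = _ ≟ 0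
  E? (inj₂ j) (inj₂ l) = ¬? (j Fin.≟ l) ×-dec all? λ r → (_ ≤? _) ×-dec (_ ≤? _)

  ∃? : {P : V → Set} → (∀ z → Dec (P z)) → Dec (∃ P)
  ∃? P? with any? (P? ∘ inj₁) | any? (P? ∘ inj₂)
  ... | yes (i , p) | _           = yes (inj₁ i , p)
  ... | no  _       | yes (j , p) = yes (inj₂ j , p)
  ... | no  ¬u      | no  ¬v      = no λ { (inj₁ i , p) → ¬u (i , p) ; (inj₂ j , p) → ¬v (j , p) }

  open Shortest _≟ᵛ_ E? ∃? public

  arc-u→v⇒coord≡0 : ∀ {i j} → Walk E (inj₁ i) (inj₂ j) 1 → coord (2 * toℕ i) j ≡ 0
  arc-u→v⇒coord≡0 (step e here) = e

  arc-v→u⇒coord≡0 : ∀ {i j} → Walk E (inj₂ j) (inj₁ i) 1 → coord (suc (2 * toℕ i)) j ≡ 0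
  arc-v→u⇒coord≡0 (step e here) = e

  walk₂-u→v⇒coord≤1 : ∀ {i j} → Walk E (inj₁ i) (inj₂ j) 2 → coord (2 * toℕ i) j ≤ 1
  walk₂-u→v⇒coord≤1 {i} (step {z = inj₂ _} e (step (_ , within) here)) =
    subst (λ c → coord (2 * toℕ i) _ ≤ suc c) e (proj₁ (within i))

  walk₂-v→u⇒coord≤1 : ∀ {i j} → Walk E (inj₂ j) (inj₁ i) 2 → coord (suc (2 * toℕ i)) j ≤ 1
  walk₂-v→u⇒coord≤1 {i} {j} (step {z = inj₂ _} (_ , within) (step e here)) =
    subst (λ c → coord (suc (2 * toℕ i)) j ≤ suc c) e (proj₂ (within i))

  module Origin (0<m : 0 < m) where

    v₁ : Fin m
    v₁ = fromℕ< 0<m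

    coord-v₁ : ∀ p → coord p v₁ ≡ 0
    coord-v₁ p rewrite toℕ-fromℕ< 0<m = digit-of-0 p

    arc-u→v₁ : ∀ i → E (inj₁ i) (inj₂ v₁)
    arc-u→v₁ i = coord-v₁ (2 * toℕ i)

    arc-v₁→u : ∀ i → E (inj₂ v₁) (inj₁ i)
    arc-v₁→u i = coord-v₁ (suc (2 * toℕ i))

  -- Since m ≤ D^(2k), every j < m has a base-D expansion with 2k digits, and lowering digits
  -- lowers the index, so it never leaves the vertex set.
  module Lowering (m≤D^2k : m ≤ D ^ (2 * k)) where

    toℕ<D^2k : ∀ (j : Fin m) → toℕ j < D ^ (2 * k)
    toℕ<D^2k j = <-≤-trans (toℕ<n j) m≤D^2k

    coord-injective : ∀ {j l} → (∀ p → p < 2 * k → coord p j ≡ coord p l) → j ≡ l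
    coord-injective {j} {l} same = toℕ-injective (digit-injective (2 * k) (toℕ<D^2k j) (toℕ<D^2k l) same)

    module _ (f : ℕ → ℕ → ℕ) (f≤ : ∀ p x → f p x ≤ x) where

      lowered : Fin m → ℕ
      lowered j = fromDigits (λ p → f p (coord p j)) (2 * k)

      lowered-< : ∀ j → lowered j < m
      lowered-< j = ≤-<-trans (fromDigits-mono-≤ (2 * k) _ _ (λ p _ → f≤ p (coord p j)))
        (subst (_< m) (sym (fromDigits-digit (2 * k) (toℕ j) (toℕ<D^2k j))) (toℕ<n j))

      lower : Fin m → Fin m
      lower j = fromℕ< (lowered-< j)

      coord-lower : ∀ j p → p < 2 * k → coord p (lower j) ≡ f p (coord p j)
      coord-lower j p p<2k rewrite toℕ-fromℕ< (lowered-< j) = digit-fromDigits (2 * k) _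
        (λ q _ → ≤-<-trans (f≤ q (coord q j)) (digit-< q (toℕ j))) p p<2k

      coord-lower-≤ : ∀ j p → p < 2 * k → coord p (lower j) ≤ coord p j
      coord-lower-≤ j p p<2k = ≤-trans (≤-reflexive (coord-lower j p p<2k)) (f≤ p (coord p j))

    clearAt : ℕ → ℕ → ℕ → ℕ
    clearAt q p x with p ≟ q
    ... | yes _ = 0
    ... | no  _ = x

    clearAt-≤ : ∀ q p x → clearAt q p x ≤ x
    clearAt-≤ q p x with p ≟ q
    ... | yes _ = z≤n
    ... | no  _ = ≤-refl

    clearAt-same : ∀ q x → clearAt q q x ≡ 0
    clearAt-same q x with q ≟ q
    ... | yes _   = refl
    ... | no  q≢q = contradiction refl q≢q

    clearAt-other : ∀ q p x → p ≢ q → clearAt q p x ≡ x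
    clearAt-other q p x p≢q with p ≟ q
    ... | yes p≡q = contradiction p≡q p≢q
    ... | no  _   = refl

    clear : ℕ → Fin m → Fin m
    clear q = lower (clearAt q) (clearAt-≤ q)

    coord-clear-≡ : ∀ q j → q < 2 * k → coord q (clear q j) ≡ 0
    coord-clear-≡ q j q<2k = trans (coord-lower (clearAt q) (clearAt-≤ q) j q q<2k) (clearAt-same q _)

    coord-clear-within : ∀ q j → coord q j ≤ 1 → ∀ p → p < 2 * k → coord p j ≤ suc (coord p (clear q j))
    coord-clear-within q j c≤1 p p<2k with p ≟ q
    ... | yes refl = subst (λ c → coord q j ≤ suc c) (sym (coord-clear-≡ q j p<2k)) c≤1
    ... | no  p≢q  = subst (λ c → coord p j ≤ suc c)
                       (sym (trans (coord-lower (clearAt q) (clearAt-≤ q) j p p<2k) (clearAt-other q p _ p≢q)))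
                       (n≤1+n _)

    clear-≢ : ∀ q j → q < 2 * k → coord q j ≡ 1 → clear q j ≢ j
    clear-≢ q j q<2k c≡1 eq = 0≢1+n (trans (sym (coord-clear-≡ q j q<2k)) (trans (cong (coord q) eq) c≡1))

    walk₂-u→v : ∀ i j → coord (2 * toℕ i) j ≡ 1 → Walk E (inj₁ i) (inj₂ j) 2
    walk₂-u→v i j c≡1 = step (coord-clear-≡ q j q<2k) (step (clear-≢ q j q<2k c≡1 , within) here)
      where
      q : ℕ
      q = 2 * toℕ i
      q<2k : q < 2 * k
      q<2k = *-monoʳ-< 2 (toℕ<n i)
      within : WithinOne (clear q j) j
      within r = coord-clear-within q j (≤-reflexive c≡1) (2 * toℕ r) (*-monoʳ-< 2 (toℕ<n r)) ,
                 ≤-trans (coord-lower-≤ (clearAt q) (clearAt-≤ q) j _ (1+2*-mono-< (toℕ<n r))) (n≤1+n _)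

    walk₂-v→u : ∀ i j → coord (suc (2 * toℕ i)) j ≡ 1 → Walk E (inj₂ j) (inj₁ i) 2
    walk₂-v→u i j c≡1 = step (clear-≢ q j q<2k c≡1 ∘ sym , within) (step (coord-clear-≡ q j q<2k) here)
      where
      q : ℕ
      q = suc (2 * toℕ i)
      q<2k : q < 2 * k
      q<2k = 1+2*-mono-< (toℕ<n i)
      within : WithinOne j (clear q j)
      within r = ≤-trans (coord-lower-≤ (clearAt q) (clearAt-≤ q) j _ (*-monoʳ-< 2 (toℕ<n r))) (n≤1+n _) ,
                 coord-clear-within q j (≤-reflexive c≡1) (suc (2 * toℕ r)) (1+2*-mono-< (toℕ<n r))

  -- For d ≤ 2 every coordinate is 0, 1 or 2, and it is read off a distance to or from some u_i.
  module SmallBase (d≤2 : d ≤ 2) (m≤D^2k : m ≤ D ^ (2 * k)) where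

    open Lowering m≤D^2k

    coord-<3 : ∀ p j → coord p j < 3
    coord-<3 p j = ≤-trans (digit-< p (toℕ j)) (s≤s d≤2)

    isDist-u→v⇒coord : ∀ {i j t} → IsDist E (inj₁ i) (inj₂ j) t → coord (2 * toℕ i) j ≡ 2 ⊓ (t ∸ 1)
    isDist-u→v⇒coord {t = zero} (w , _) = contradiction (walk₀⇒≡ w) λ ()
    isDist-u→v⇒coord {t = 1}    (w , _) = arc-u→v⇒coord≡0 w
    isDist-u→v⇒coord {i} {j} {t = 2} (w , least) with coord (2 * toℕ i) j in eq | walk₂-u→v⇒coord≤1 w
    ... | 0           | _          = contradiction (step eq here) (least 1 ≤-refl)
    ... | 1           | _          = refl
    ... | suc (suc _) | s≤s ()
    isDist-u→v⇒coord {i} {j} {t = suc (suc (suc _))} (_ , least) with coord (2 * toℕ i) j in eq | coord-<3 (2 * toℕ i) j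
    ... | 0 | _ = contradiction (step eq here) (least 1 (s≤s (s≤s z≤n)))
    ... | 1 | _ = contradiction (walk₂-u→v i j eq) (least 2 (s≤s (s≤s (s≤s z≤n))))
    ... | 2 | _ = refl
    ... | suc (suc (suc _)) | s≤s (s≤s (s≤s ()))

    isDist-v→u⇒coord : ∀ {i j t} → IsDist E (inj₂ j) (inj₁ i) t → coord (suc (2 * toℕ i)) j ≡ 2 ⊓ (t ∸ 1)
    isDist-v→u⇒coord {t = zero} (w , _) = contradiction (walk₀⇒≡ w) λ ()
    isDist-v→u⇒coord {t = 1}    (w , _) = arc-v→u⇒coord≡0 w
    isDist-v→u⇒coord {i} {j} {t = 2} (w , least) with coord (suc (2 * toℕ i)) j in eq | walk₂-v→u⇒coord≤1 w
    ... | 0           | _          = contradiction (step eq here) (least 1 ≤-refl)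
    ... | 1           | _          = refl
    ... | suc (suc _) | s≤s ()
    isDist-v→u⇒coord {i} {j} {t = suc (suc (suc _))} (_ , least) with coord (suc (2 * toℕ i)) j in eq | coord-<3 (suc (2 * toℕ i)) j
    ... | 0 | _ = contradiction (step eq here) (least 1 (s≤s (s≤s z≤n)))
    ... | 1 | _ = contradiction (walk₂-v→u i j eq) (least 2 (s≤s (s≤s (s≤s z≤n))))
    ... | 2 | _ = refl
    ... | suc (suc (suc _)) | s≤s (s≤s (s≤s ()))

    module _ (reach≤D : ∀ x y → Reach x y D) where

      diameter≤ : ∀ x y → ∃[ t ] (IsDist E x y t × t ≤ D)
      diameter≤ x y = reach⇒isDist (reach≤D x y)

      us : List V
      us = map inj₁ (allFin k)

      length-us : length us ≡ k
      length-us = trans (length-map inj₁ (allFin k)) (length-tabulate (λ i → i))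

      u∈us : ∀ i → inj₁ i ∈ us
      u∈us i = ∈-map⁺ inj₁ (∈-allFin i)

      us-resolving : WeaklyResolving E us
      us-resolving (inj₁ i) v same =
        walk₀⇒≡ (proj₁ (Equivalence.to (proj₁ (same (inj₁ i) (u∈us i)) 0) isDist-refl))
      us-resolving (inj₂ j) (inj₁ i) same =
        sym (walk₀⇒≡ (proj₁ (Equivalence.from (proj₁ (same (inj₁ i) (u∈us i)) 0) isDist-refl)))
      us-resolving (inj₂ j) (inj₂ l) same = cong inj₂ (coord-injective same-coord)
        where
        same-even : ∀ i → coord (2 * toℕ i) j ≡ coord (2 * toℕ i) l
        same-even i = let t , dist , _ = diameter≤ (inj₁ i) (inj₂ j) in
          trans (isDist-u→v⇒coord dist)
                (sym (isDist-u→v⇒coord (Equivalence.to (proj₁ (same (inj₁ i) (u∈us i)) t) dist)))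
        same-odd : ∀ i → coord (suc (2 * toℕ i)) j ≡ coord (suc (2 * toℕ i)) l
        same-odd i = let t , dist , _ = diameter≤ (inj₂ j) (inj₁ i) in
          trans (isDist-v→u⇒coord dist)
                (sym (isDist-v→u⇒coord (Equivalence.to (proj₂ (same (inj₁ i) (u∈us i)) t) dist)))
        same-coord : ∀ p → p < 2 * k → coord p j ≡ coord p l
        same-coord p p<2k with position-split p p<2k
        ... | i , inj₁ p≡2i   = subst (λ q → coord q j ≡ coord q l) (sym p≡2i) (same-even i)
        ... | i , inj₂ p≡2i+1 = subst (λ q → coord q j ≡ coord q l) (sym p≡2i+1) (same-odd i)

      hasDiameter : 0 < k → 1 ≤ d → d < m → HasDiameter E D
      hasDiameter 0<k 1≤d d<m = diameter≤ , inj₁ i , inj₂ j , far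
        where
        i : Fin k
        i = fromℕ< 0<k
        j : Fin m
        j = fromℕ< d<m
        coord-j : coord (2 * toℕ i) j ≡ d
        coord-j rewrite toℕ-fromℕ< 0<k | toℕ-fromℕ< d<m = m<n⇒m%n≡m (n<1+n d)
        far : IsDist E (inj₁ i) (inj₂ j) D
        far = let t , dist , t≤D = diameter≤ (inj₁ i) (inj₂ j) in
          subst (IsDist E _ _) (2⊓[t∸1]≡d⇒t≡1+d 1≤d d≤2 t≤D (trans (sym coord-j) (isDist-u→v⇒coord dist))) dist

module Γ₂ (n k : ℕ) (0<m : 0 < n ∸ k) where

  open Γ n 1 k
  open Origin 0<m

  coord-≤1 : ∀ p j → coord p j ≤ 1
  coord-≤1 p j = ≤-pred (digit-< p (toℕ j))

  -- v₁ has all coordinates 0, so with coordinates in {0, 1} every vertex is within one step of it.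
  reach-to-v₁ : ∀ x → Reach x (inj₂ v₁) 1
  reach-to-v₁ (inj₁ i) = reach-arc (arc-u→v₁ i)
  reach-to-v₁ (inj₂ j) = reach-withinOne λ r →
    subst (_≤ suc (coord (2 * toℕ r) j)) (sym (coord-v₁ (2 * toℕ r))) z≤n ,
    subst (λ c → coord (suc (2 * toℕ r)) j ≤ suc c) (sym (coord-v₁ (suc (2 * toℕ r)))) (coord-≤1 (suc (2 * toℕ r)) j)

  reach-from-v₁ : ∀ y → Reach (inj₂ v₁) y 1
  reach-from-v₁ (inj₁ i) = reach-arc (arc-v₁→u i)
  reach-from-v₁ (inj₂ l) = reach-withinOne λ r →
    subst (λ c → coord (2 * toℕ r) l ≤ suc c) (sym (coord-v₁ (2 * toℕ r))) (coord-≤1 (2 * toℕ r) l) ,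
    subst (_≤ suc (coord (suc (2 * toℕ r)) l)) (sym (coord-v₁ (suc (2 * toℕ r)))) z≤n

  reach≤2 : ∀ x y → Reach x y 2
  reach≤2 x y = reach-trans (reach-to-v₁ x) (reach-from-v₁ y)

-- A route of length 3 from v_a to v_b: lower every odd coordinate of a by one, then jump to b with its even
-- coordinates lowered by one, then raise them; with coordinates in {0, 1, 2} each of the three moves is an arc.
module Γ₃ (n k : ℕ) (m≤D^2k : n ∸ k ≤ 3 ^ (2 * k)) (0<m : 0 < n ∸ k) where

  open Γ n 2 k
  open Origin 0<m
  open Lowering m≤D^2k
  open SmallBase ≤-refl m≤D^2k using (coord-<3)

  [2*r]%2≡0 : ∀ r → (2 * r) % 2 ≡ 0
  [2*r]%2≡0 r = trans (cong (_% 2) (*-comm 2 r)) (m*n%n≡0 r 2)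

  [1+2*r]%2≡1 : ∀ r → suc (2 * r) % 2 ≡ 1
  [1+2*r]%2≡1 r = trans (cong (λ x → suc x % 2) (*-comm 2 r)) ([m+kn]%n≡m%n 1 r 2)

  dropOdd dropEven : ℕ → ℕ → ℕ
  dropOdd  p x = x ∸ p % 2
  dropEven p x = x ∸ (1 ∸ p % 2)

  dropOdd-≤ : ∀ p x → dropOdd p x ≤ x
  dropOdd-≤ p x = m∸n≤m x (p % 2)

  dropEven-≤ : ∀ p x → dropEven p x ≤ x
  dropEven-≤ p x = m∸n≤m x (1 ∸ p % 2)

  lowerOdd lowerEven : Fin m → Fin m
  lowerOdd  = lower dropOdd dropOdd-≤
  lowerEven = lower dropEven dropEven-≤

  module _ (r : Fin k) where

    coord-lowerOdd-even : ∀ a → coord (2 * toℕ r) (lowerOdd a) ≡ coord (2 * toℕ r) a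
    coord-lowerOdd-even a = trans (coord-lower dropOdd dropOdd-≤ a (2 * toℕ r) (*-monoʳ-< 2 (toℕ<n r)))
      (cong (coord (2 * toℕ r) a ∸_) ([2*r]%2≡0 (toℕ r)))

    coord-lowerOdd-odd : ∀ a → coord (suc (2 * toℕ r)) (lowerOdd a) ≡ coord (suc (2 * toℕ r)) a ∸ 1
    coord-lowerOdd-odd a = trans (coord-lower dropOdd dropOdd-≤ a (suc (2 * toℕ r)) (1+2*-mono-< (toℕ<n r)))
      (cong (coord (suc (2 * toℕ r)) a ∸_) ([1+2*r]%2≡1 (toℕ r)))

    coord-lowerEven-even : ∀ b → coord (2 * toℕ r) (lowerEven b) ≡ coord (2 * toℕ r) b ∸ 1
    coord-lowerEven-even b = trans (coord-lower dropEven dropEven-≤ b (2 * toℕ r) (*-monoʳ-< 2 (toℕ<n r)))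
      (cong (λ c → coord (2 * toℕ r) b ∸ (1 ∸ c)) ([2*r]%2≡0 (toℕ r)))

    coord-lowerEven-odd : ∀ b → coord (suc (2 * toℕ r)) (lowerEven b) ≡ coord (suc (2 * toℕ r)) b
    coord-lowerEven-odd b = trans (coord-lower dropEven dropEven-≤ b (suc (2 * toℕ r)) (1+2*-mono-< (toℕ<n r)))
      (cong (λ c → coord (suc (2 * toℕ r)) b ∸ (1 ∸ c)) ([1+2*r]%2≡1 (toℕ r)))

  [x∸1]≤1+y : ∀ {x} y → x < 3 → x ∸ 1 ≤ suc y
  [x∸1]≤1+y y x<3 = ≤-trans (∸-monoˡ-≤ 1 (≤-pred x<3)) (s≤s z≤n)

  within-lowerOdd : ∀ a → WithinOne a (lowerOdd a)
  within-lowerOdd a r rewrite coord-lowerOdd-even r a | coord-lowerOdd-odd r a = n≤1+n _ , m≤n+m∸n _ 1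

  within-lowerOdd-lowerEven : ∀ a b → WithinOne (lowerOdd a) (lowerEven b)
  within-lowerOdd-lowerEven a b r rewrite coord-lowerEven-even r b | coord-lowerOdd-odd r a =
    [x∸1]≤1+y _ (coord-<3 (2 * toℕ r) b) , [x∸1]≤1+y _ (coord-<3 (suc (2 * toℕ r)) a)

  within-lowerEven : ∀ b → WithinOne (lowerEven b) b
  within-lowerEven b r rewrite coord-lowerEven-even r b | coord-lowerEven-odd r b = m≤n+m∸n _ 1 , n≤1+n _

  within-v₁-lowerEven : ∀ b → WithinOne v₁ (lowerEven b)
  within-v₁-lowerEven b r rewrite coord-lowerEven-even r b | coord-v₁ (2 * toℕ r) | coord-v₁ (suc (2 * toℕ r)) =
    [x∸1]≤1+y 0 (coord-<3 (2 * toℕ r) b) , z≤n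

  within-lowerOdd-v₁ : ∀ a → WithinOne (lowerOdd a) v₁
  within-lowerOdd-v₁ a r rewrite coord-lowerOdd-odd r a | coord-v₁ (2 * toℕ r) | coord-v₁ (suc (2 * toℕ r)) =
    z≤n , [x∸1]≤1+y 0 (coord-<3 (suc (2 * toℕ r)) a)

  reach≤3 : ∀ x y → Reach x y 3
  reach≤3 (inj₁ i) (inj₁ i′) = reach-mono (n≤1+n 2)
    (reach-trans {y = inj₂ v₁} (reach-arc (arc-u→v₁ i)) (reach-arc (arc-v₁→u i′)))
  reach≤3 (inj₁ i) (inj₂ b)  = reach-trans (reach-arc (arc-u→v₁ i))
    (reach-trans (reach-withinOne (within-v₁-lowerEven b)) (reach-withinOne (within-lowerEven b)))
  reach≤3 (inj₂ a) (inj₁ i)  = reach-trans (reach-withinOne (within-lowerOdd a))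
    (reach-trans (reach-withinOne (within-lowerOdd-v₁ a)) (reach-arc (arc-v₁→u i)))
  reach≤3 (inj₂ a) (inj₂ b)  = reach-trans (reach-withinOne (within-lowerOdd a))
    (reach-trans (reach-withinOne (within-lowerOdd-lowerEven a b)) (reach-withinOne (within-lowerEven b)))

splitAt-injective : ∀ k m {i j : Fin (k + m)} → splitAt k i ≡ splitAt k j → i ≡ j
splitAt-injective k m {i} {j} eq =
  trans (sym (join-splitAt k m i)) (trans (cong (join k m) eq) (join-splitAt k m j))

Γ-small-diameter-dim : ∀ {n d k} → 1 ≤ d → d ≤ 2 → IsF n (suc d) k → d < n ∸ k →
                       (∀ x y → Γ.Reach n d k x y (suc d)) →
                       HasDiameter (ΓE n (suc d) k) (suc d) × HasDim (ΓE n (suc d) k) k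
Γ-small-diameter-dim {n} {d} {k} 1≤d d≤2 isF d<m reach≤D =
  hasDiameter reach≤D (proj₁ isF) 1≤d d<m ,
  (us reach≤D , length-us reach≤D , us-resolving reach≤D) ,
  λ W resolving → isF-least (length W) isF 2≤n (≤-trans (m≤n+m∸n n k)
    (resolving-bound W resolving (k + (n ∸ k)) (splitAt k) (splitAt-injective k (n ∸ k))))
  where
  open Γ n d k
  open SmallBase d≤2 (isF⇒n∸k≤D^2k isF)
  open ResolvingBound E _≟ᵛ_ d (diameter≤ reach≤D)
  2≤n : 2 ≤ n
  2≤n = ≤-trans (s≤s 1≤d) (≤-trans d<m (m∸n≤m n k))

Γ₂-diameter-dim : ∀ n k → 3 ≤ n → IsF n 2 k → HasDiameter (ΓE n 2 k) 2 × HasDim (ΓE n 2 k) k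
Γ₂-diameter-dim n k 3≤n isF = Γ-small-diameter-dim ≤-refl (s≤s z≤n) isF 1<m (Γ₂.reach≤2 n k (≤-trans (s≤s z≤n) 1<m))
  where
  1<m : 1 < n ∸ k
  1<m = isF⇒≤n∸k isF (s≤s (s≤s z≤n)) 3≤n

Γ₃-diameter-dim : ∀ n k → 4 ≤ n → IsF n 3 k → HasDiameter (ΓE n 3 k) 3 × HasDim (ΓE n 3 k) k
Γ₃-diameter-dim n k 4≤n isF =
  Γ-small-diameter-dim (s≤s z≤n) ≤-refl isF 2<m (Γ₃.reach≤3 n k (isF⇒n∸k≤D^2k isF) (≤-trans (s≤s z≤n) 2<m))
  where
  2<m : 2 < n ∸ k
  2<m = isF⇒≤n∸k isF ≤-refl 4≤n

-- With k = 1 there is one vertex u, and v_j has two coordinates a = coord 0 j and b = coord 1 j: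
-- ∂(u, v_j) = 1 + a and ∂(v_j, u) = 1 + b, so u alone resolves the digraph.
module Γ₁ (n d : ℕ) (m≤D^2 : n ∸ 1 ≤ suc d ^ (2 * 1)) where

  open Γ n d 1
  open Lowering m≤D^2 using (toℕ<D^2k; coord-injective)

  u : V
  u = inj₁ Fin.zero

  coord-index-< : ∀ j → coord 0 j + coord 1 j * D < m
  coord-index-< j = subst (_< m) (sym coord-index) (toℕ<n j)
    where
    coord-index : coord 0 j + coord 1 j * D ≡ toℕ j
    coord-index = trans (cong (λ c → coord 0 j + c * D) (sym (+-identityʳ (coord 1 j))))
      (fromDigits-digit 2 (toℕ j) (toℕ<D^2k j))

  vertex : ∀ a b → a + b * D < m → Fin m
  vertex a b a+b*D<m = fromℕ< a+b*D<m

  module _ {a b} (a<D : a < D) (b<D : b < D) (a+b*D<m : a + b * D < m) where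

    coord-0-vertex : coord 0 (vertex a b a+b*D<m) ≡ a
    coord-0-vertex rewrite toℕ-fromℕ< a+b*D<m = digit-head b a<D

    coord-1-vertex : coord 1 (vertex a b a+b*D<m) ≡ b
    coord-1-vertex rewrite toℕ-fromℕ< a+b*D<m = trans (digit-tail 0 b a<D) (m<n⇒m%n≡m b<D)

  reach-within : ∀ {j l} → coord 0 l ≤ suc (coord 0 j) → coord 1 j ≤ suc (coord 1 l) → Reach (inj₂ j) (inj₂ l) 1
  reach-within a≤ b≤ = reach-withinOne λ { Fin.zero → a≤ , b≤ }

  -- One greedy step raises the first coordinate towards that of l and lowers the second.
  reach-greedy : ∀ s j l → coord 0 l ≤ suc (s + coord 0 j) → coord 1 j ≤ suc (s + coord 1 l) →
                 Reach (inj₂ j) (inj₂ l) (suc s)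
  reach-greedy zero    j l a≤ b≤ = reach-within a≤ b≤
  reach-greedy (suc s) j l a′≤ b≤ = reach-trans
      (reach-within (subst (_≤ suc a) (sym a₁≡) (m⊓n≤n a′ (suc a)))
                    (≤-trans (m≤n+m∸n b 1) (s≤s (subst (b ∸ 1 ≤_) (sym b₁≡) (m≤n⊔m b′ (b ∸ 1))))))
      (reach-greedy s next l
        (subst (λ c → a′ ≤ suc (s + c)) (sym a₁≡) a′≤1+s+a₁)
        (subst (_≤ suc (s + b′)) (sym b₁≡) b₁≤1+s+b′))
    where
    a b a′ b′ a₁ b₁ : ℕ
    a = coord 0 j
    b = coord 1 j
    a′ = coord 0 l
    b′ = coord 1 l
    a₁ = a′ ⊓ suc a
    b₁ = b′ ⊔ (b ∸ 1)
    a′≤1+s+a₁ : a′ ≤ suc (s + a₁)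
    a′≤1+s+a₁ = subst (a′ ≤_) (cong suc (sym (+-distribˡ-⊓ s a′ (suc a))))
      (⊓-glb (≤-trans (m≤n+m a′ s) (n≤1+n _)) (subst (a′ ≤_) (cong suc (sym (+-suc s a))) a′≤))
    b₁≤1+s+b′ : b₁ ≤ suc (s + b′)
    b₁≤1+s+b′ = ⊔-lub (≤-trans (m≤n+m b′ s) (n≤1+n _)) (∸-monoˡ-≤ 1 b≤)
    a₁<D : a₁ < D
    a₁<D = ≤-<-trans (m⊓n≤m a′ (suc a)) (digit-< 0 (toℕ l))
    b₁<D : b₁ < D
    b₁<D = ⊔-lub (digit-< 1 (toℕ l)) (≤-<-trans (m∸n≤m b 1) (digit-< 1 (toℕ j)))
    -- Either b₁ = b′ and a₁ ≤ a′, or b₁ < b: in both cases the index stays below that of l or of j.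
    index<m : a₁ + b₁ * D < m
    index<m with b ∸ 1 ≤? b′
    ... | yes b-1≤b′ = subst (λ c → a₁ + c * D < m) (sym (m≥n⇒m⊔n≡m b-1≤b′))
          (≤-<-trans (x+y*D-mono-≤ {y = b′} (m⊓n≤m a′ (suc a)) ≤-refl) (coord-index-< l))
    ... | no  b-1≰b′ = subst (λ c → a₁ + c * D < m) (sym (m≤n⇒m⊔n≡n (<⇒≤ b′<b-1)))
          (<-trans (x+y*D<x′+y′*D {x′ = a} a₁<D (pred-< {b} b′<b-1)) (coord-index-< j))
      where
      b′<b-1 : b′ < b ∸ 1
      b′<b-1 = ≰⇒> b-1≰b′
      pred-< : ∀ {x y} → y < x ∸ 1 → x ∸ 1 < x
      pred-< {suc x} _ = ≤-refl
    next : Fin m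
    next = vertex a₁ b₁ index<m
    a₁≡ : coord 0 next ≡ a₁
    a₁≡ = coord-0-vertex a₁<D b₁<D index<m
    b₁≡ : coord 1 next ≡ b₁
    b₁≡ = coord-1-vertex a₁<D b₁<D index<m

  first second : V → ℕ
  first  (inj₁ _) = 0
  first  (inj₂ j) = suc (coord 0 j)
  second (inj₁ _) = 0
  second (inj₂ j) = suc (coord 1 j)

  -- No arc raises the first coordinate by more than one, nor lowers the second by more than one.
  walk-first : ∀ {x y t} → Walk E x y t → first y ≤ t + first x
  walk-first here = ≤-refl
  walk-first {x} {t = suc t} (step {z = z} e w) =
    ≤-trans (walk-first w) (≤-trans (+-monoʳ-≤ t (arc-first x z e)) (≤-reflexive (+-suc t (first x))))
    where
    arc-first : ∀ x z → E x z → first z ≤ suc (first x)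
    arc-first (inj₁ Fin.zero) (inj₂ j) c≡0 = s≤s (≤-reflexive c≡0)
    arc-first (inj₂ j) (inj₁ _) _ = z≤n
    arc-first (inj₂ j) (inj₂ l) (_ , within) = s≤s (proj₁ (within Fin.zero))

  walk-second : ∀ {x y t} → Walk E x y t → second x ≤ t + second y
  walk-second here = ≤-refl
  walk-second {x} (step {z = z} e w) = ≤-trans (arc-second x z e) (s≤s (walk-second w))
    where
    arc-second : ∀ x z → E x z → second x ≤ suc (second z)
    arc-second (inj₁ _) (inj₂ l) _ = z≤n
    arc-second (inj₂ j) (inj₁ Fin.zero) c≡0 = s≤s (≤-reflexive c≡0)
    arc-second (inj₂ j) (inj₂ l) (_ , within) = s≤s (proj₂ (within Fin.zero))

  reach-u→v : ∀ j → Reach u (inj₂ j) (suc (coord 0 j))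
  reach-u→v j with coord 0 j in a≡
  ... | zero  = reach-arc a≡
  ... | suc a = reach-trans (reach-arc start-0) (reach-greedy a start j
      (≤-trans (≤-reflexive a≡) (subst (λ c → suc a ≤ suc (a + c)) (sym start-0) (s≤s (m≤m+n a 0))))
      (subst (_≤ suc (a + b)) (sym start-1) (≤-trans (m≤n+m b a) (n≤1+n _))))
    where
    b : ℕ
    b = coord 1 j
    index<m : 0 + b * D < m
    index<m = ≤-<-trans (m≤n+m _ (coord 0 j)) (coord-index-< j)
    start : Fin m
    start = vertex 0 b index<m
    start-0 : coord 0 start ≡ 0
    start-0 = coord-0-vertex z<s (digit-< 1 (toℕ j)) index<m
    start-1 : coord 1 start ≡ b
    start-1 = coord-1-vertex z<s (digit-< 1 (toℕ j)) index<m

  reach-v→u : ∀ j → Reach (inj₂ j) u (suc (coord 1 j))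
  reach-v→u j with coord 1 j in b≡
  ... | zero  = reach-arc b≡
  ... | suc b = reach-mono (≤-reflexive (+-comm (suc b) 1)) (reach-trans (reach-greedy b j end
      (subst (_≤ suc (b + a)) (sym end-0) (≤-trans (m≤n+m a b) (n≤1+n _)))
      (≤-trans (≤-reflexive b≡) (subst (λ c → suc b ≤ suc (b + c)) (sym end-1) (s≤s (m≤m+n b 0)))))
      (reach-arc end-1))
    where
    a : ℕ
    a = coord 0 j
    index<m : a + 0 * D < m
    index<m = ≤-<-trans (+-monoʳ-≤ a z≤n) (coord-index-< j)
    end : Fin m
    end = vertex a 0 index<m
    end-0 : coord 0 end ≡ a
    end-0 = coord-0-vertex (digit-< 0 (toℕ j)) z<s index<m
    end-1 : coord 1 end ≡ 0
    end-1 = coord-1-vertex (digit-< 0 (toℕ j)) z<s index<m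

  isDist-u→v : ∀ j → IsDist E u (inj₂ j) (suc (coord 0 j))
  isDist-u→v j = reach⇒isDist-if-least (reach-u→v j) λ t w → subst (_ ≤_) (+-identityʳ t) (walk-first w)

  isDist-v→u : ∀ j → IsDist E (inj₂ j) u (suc (coord 1 j))
  isDist-v→u j = reach⇒isDist-if-least (reach-v→u j) λ t w → subst (_ ≤_) (+-identityʳ t) (walk-second w)

  reach≤D : ∀ x y → Reach x y D
  reach≤D (inj₁ Fin.zero) (inj₁ Fin.zero) = reach-refl
  reach≤D (inj₁ Fin.zero) (inj₂ l) = reach-mono (digit-< 0 (toℕ l)) (reach-u→v l)
  reach≤D (inj₂ j) (inj₁ Fin.zero) = reach-mono (digit-< 1 (toℕ j)) (reach-v→u j)
  reach≤D (inj₂ j) (inj₂ l) = reach-greedy d j l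
    (≤-trans (≤-pred (digit-< 0 (toℕ l))) (≤-trans (m≤m+n d _) (n≤1+n _)))
    (≤-trans (≤-pred (digit-< 1 (toℕ j))) (≤-trans (m≤m+n d _) (n≤1+n _)))

  hasDiameter : d < m → HasDiameter E D
  hasDiameter d<m = (λ x y → reach⇒isDist (reach≤D x y)) , u , inj₂ far ,
    subst (IsDist E u (inj₂ far)) (cong suc far-0) (isDist-u→v far)
    where
    far : Fin m
    far = fromℕ< d<m
    far-0 : coord 0 far ≡ d
    far-0 rewrite toℕ-fromℕ< d<m = m<n⇒m%n≡m (n<1+n d)

  u-resolving : WeaklyResolving E (u ∷ [])
  u-resolving (inj₁ Fin.zero) v same =
    walk₀⇒≡ (proj₁ (Equivalence.to (proj₁ (same u (here refl)) 0) isDist-refl))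
  u-resolving (inj₂ j) (inj₁ Fin.zero) same =
    sym (walk₀⇒≡ (proj₁ (Equivalence.from (proj₁ (same u (here refl)) 0) isDist-refl)))
  u-resolving (inj₂ j) (inj₂ l) same = cong inj₂ (coord-injective λ
    { 0 _ → suc-injective (isDist-unique (Equivalence.to (proj₁ (same u (here refl)) _) (isDist-u→v j)) (isDist-u→v l))
    ; 1 _ → suc-injective (isDist-unique (Equivalence.to (proj₂ (same u (here refl)) _) (isDist-v→u j)) (isDist-v→u l))
    ; (suc (suc _)) (s≤s (s≤s ())) })

  nonempty-if-resolving : 0 < m → ∀ W → WeaklyResolving E W → 1 ≤ length W
  nonempty-if-resolving 0<m []      resolving with resolving u (inj₂ (fromℕ< 0<m)) (λ _ ())
  ... | ()
  nonempty-if-resolving 0<m (_ ∷ _) _ = s≤s z≤n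

Γ₁-diameter-dim : (n d : ℕ) → 2 ≤ d → d + 1 ≤ n → n ≤ d * d + 1 →
                  IsF n d 1 × HasDiameter (ΓE n d 1) d × HasDim (ΓE n d 1) 1
Γ₁-diameter-dim n zero    ()
Γ₁-diameter-dim n (suc d) _ d+2≤n n≤D*D+1 =
  (≤-refl , n≤1+D^2 , λ _ 1≤j j<1 → contradiction (≤-trans 1≤j (≤-pred j<1)) λ ()) ,
  hasDiameter d<m ,
  (u ∷ [] , refl , u-resolving) , nonempty-if-resolving (≤-trans (s≤s z≤n) d<m)
  where
  D : ℕ
  D = suc d
  D^2≡D*D : D ^ (2 * 1) ≡ D * D
  D^2≡D*D = cong (D *_) (*-identityʳ D)
  n≤1+D^2 : n ≤ 1 + D ^ (2 * 1)
  n≤1+D^2 = subst (n ≤_) (trans (+-comm (D * D) 1) (cong (1 +_) (sym D^2≡D*D))) n≤D*D+1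
  m≤D^2 : n ∸ 1 ≤ D ^ (2 * 1)
  m≤D^2 = ∸-monoˡ-≤ 1 n≤1+D^2
  d<m : d < n ∸ 1
  d<m = subst (_≤ n ∸ 1) (m+n∸n≡m D 1) (∸-monoˡ-≤ 1 d+2≤n)
  open Γ₁ n d m≤D^2

lemma2p5 : ((n d : ℕ) → 2 ≤ d → d + 1 ≤ n → n ≤ d * d + 1 →
    IsF n d 1 × HasDiameter (ΓE n d 1) d × HasDim (ΓE n d 1) 1)
    × ((n k : ℕ) → 3 ≤ n → IsF n 2 k →
    HasDiameter (ΓE n 2 k) 2 × HasDim (ΓE n 2 k) k)
    × ((n k : ℕ) → 4 ≤ n → IsF n 3 k →
    HasDiameter (ΓE n 3 k) 3 × HasDim (ΓE n 3 k) k)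
lemma2p5 = Γ₁-diameter-dim , Γ₂-diameter-dim , Γ₃-diameter-dim
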